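{- For any integer $r\geq 2$, there exists a set of seven mutually orthogoval $\mathrm{AG}(r,\mathbb{F}_3)$.
   Context: $\mathrm{AG}(r,\mathbb{F}_3)$ is the $r$-dimensional affine space over the field with $3$ elements. A pair of spaces, both affine, of the same dimension and order and on the same point set (two incidence structures on a common point set, each isomorphic to the given space) are orthogoval if each line of one space intersects each line of the other space in at most two points. A set of such spaces is mutually orthogoval if every two distinct members are orthogoval. -}

module Defs where

open import Data.Nat using (ℕ)
open import Data.Fin using (Fin; zero; suc)
open import Data.Vec using (Vec; zipWith; map; replicate)
open import Data.Product using (∃; _×_)
open import Relation.Binary.PropositionalEquality using (_≡_; _≢_)
open import Relation.Nullary using (¬_)
open import Function.Bundles using (_↔_; Inverse)

F₃ : Set
F₃ = Fin 3

_+₃_ : F₃ → F₃ → F₃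
zero +₃ y = y
suc zero +₃ zero = suc zero
suc zero +₃ suc zero = suc (suc zero)
suc zero +₃ suc (suc zero) = zero
suc (suc zero) +₃ zero = suc (suc zero)
suc (suc zero) +₃ suc zero = zero
suc (suc zero) +₃ suc (suc zero) = suc zero

_*₃_ : F₃ → F₃ → F₃
zero *₃ y = zero
suc zero *₃ y = y
suc (suc zero) *₃ zero = zero
suc (suc zero) *₃ suc zero = suc (suc zero)
suc (suc zero) *₃ suc (suc zero) = suc zero

Point : ℕ → Set
Point r = Vec F₃ r

_⊕_ : ∀ {r} → Point r → Point r → Point r
_⊕_ = zipWith _+₃_

_·_ : ∀ {r} → F₃ → Point r → Point r
t · v = map (t *₃_) v

𝟎 : ∀ {r} → Point r
𝟎 = replicate _ zero

record Line (r : ℕ) : Set where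
  constructor line
  field
    base : Point r
    dir  : Point r
    dir≢0 : dir ≢ 𝟎

_∈AG_ : ∀ {r} → Point r → Line r → Set
p ∈AG L = ∃ λ (t : F₃) → p ≡ (Line.base L ⊕ (t · Line.dir L))

-- An incidence structure on the point set F₃^r isomorphic to AG(r, F₃):
-- it is given by a bijection σ of the point set, and its lines are the
-- images σ(L) of the lines L of the standard AG(r, F₃).
AGCopy : ℕ → Set
AGCopy r = Point r ↔ Point r

_∈[_]_ : ∀ {r} → Point r → AGCopy r → Line r → Set
p ∈[ σ ] L = ∃ λ q → q ∈AG L × p ≡ Inverse.to σ q

Orthogoval : ∀ {r} → AGCopy r → AGCopy r → Set
Orthogoval {r} σ τ = (L M : Line r) (p q s : Point r) →
  p ≢ q → p ≢ s → q ≢ s →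
  ¬ ((p ∈[ σ ] L × p ∈[ τ ] M) × (q ∈[ σ ] L × q ∈[ τ ] M) × (s ∈[ σ ] L × s ∈[ τ ] M))

MutuallyOrthogoval : ∀ {r k} → (Fin k → AGCopy r) → Set
MutuallyOrthogoval {k = k} S = (i j : Fin k) → i ≢ j → Orthogoval (S i) (S j)

module Submission where

-- Three pairwise distinct points of AG(r, F₃) are collinear iff they sum to 0, so two copies σ, τ
-- are orthogoval as soon as τ⁻¹σ maps no line onto a line.  If g is a permutation whose powers
-- g, …, g⁶ all have this property, the copies g⁰, …, g⁶ are mutually orthogoval, because
-- (gʲ)⁻¹gⁱ = gⁱ⁻ʲ.  Such a g, of order 7, is exhibited in dimensions 2 and 3 and checked by
-- evaluation.  The coordinatewise product of two such permutations is again one: a triple with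
-- sum 0 and two equal entries is constant, so a line of AG(m + n) projects onto a line of one of
-- the two factors.  Every r ≥ 2 is a sum of 2s and at most one 3.

open import Defs
open import Data.Empty using (⊥-elim)
open import Data.Fin using (Fin; toℕ)
open import Data.Fin.Patterns using (0F; 1F; 2F)
open import Data.Fin.Properties using (all?; toℕ-injective; toℕ≤pred[n]) renaming (_≟_ to _≟₃_)
open import Data.Nat using (ℕ; zero; suc; _+_; _<_; _≤_; s≤s; z≤n; z<s)
open import Data.Nat.GeneralisedArithmetic using (fold; fold-+)
open import Data.Nat.Properties
  using (allUpTo?; +-comm; +-suc; m<n+m; <-≤-trans; <-cmp; m≤n⇒∃[o]m+o≡n)
open import Data.Product using (∃; _,_)
open import Data.Sum using (_⊎_; inj₁; inj₂)
open import Data.Vec using (Vec; []; _∷_; _++_; take; drop)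
open import Data.Vec.Properties
  using ( ≡-dec; ∷-injectiveˡ; ∷-injectiveʳ; take-zipWith; drop-zipWith; take++drop≡id
        ; ++-injectiveˡ; ++-injectiveʳ)
open import Function using (_∘_; id; _↔_; Inverse; mk↔ₛ′)
open import Function.Construct.Composition using (_↔-∘_)
open import Function.Construct.Identity using (↔-id)
open import Level using (Level)
open import Relation.Binary.Definitions using (tri<; tri≈; tri>)
open import Relation.Binary.PropositionalEquality
  using (_≡_; _≢_; _≗_; refl; sym; trans; cong; cong₂; subst; module ≡-Reasoning)
open import Relation.Nullary using (Dec; yes; no)
open import Relation.Nullary.Decidable using (toWitness; map′; ¬?; _→-dec_)
open import Relation.Unary using (Decidable)

open Inverse

private
  variable
    ℓ : Level
    A : Set ℓ
    r m n : ℕ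
    x y z : Point r

∀₃? : {P : F₃ → Set} → Decidable P → Dec (∀ a → P a)
∀₃? = all?

∀-Point? : {P : Point r → Set} → Decidable P → Dec (∀ x → P x)
∀-Point? {zero}  P? = map′ (λ { p [] → p }) (λ h → h []) (P? [])
∀-Point? {suc r} P? = map′ (λ { h (a ∷ x) → h a x }) (λ h a x → h (a ∷ x))
  (∀₃? λ a → ∀-Point? λ x → P? (a ∷ x))

_≟_ : (x y : Point r) → Dec (x ≡ y)
_≟_ = ≡-dec _≟₃_

+₃-collinear : ∀ t₁ t₂ t₃ b d → t₁ ≢ t₂ → t₁ ≢ t₃ → t₂ ≢ t₃ →
               ((b +₃ (t₁ *₃ d)) +₃ (b +₃ (t₂ *₃ d))) +₃ (b +₃ (t₃ *₃ d)) ≡ 0F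
+₃-collinear = toWitness {a? = ∀₃? λ t₁ → ∀₃? λ t₂ → ∀₃? λ t₃ → ∀₃? λ b → ∀₃? λ d →
  ¬? (t₁ ≟₃ t₂) →-dec ¬? (t₁ ≟₃ t₃) →-dec ¬? (t₂ ≟₃ t₃) →-dec (_ ≟₃ _)} _

+₃-sum≡0⇒≡third : ∀ a b c → (a +₃ b) +₃ c ≡ 0F → c ≡ 2F *₃ (a +₃ b)
+₃-sum≡0⇒≡third = toWitness {a? = ∀₃? λ a → ∀₃? λ b → ∀₃? λ c → (_ ≟₃ _) →-dec (_ ≟₃ _)} _

+₃-third-sum≡0 : ∀ a b → (a +₃ b) +₃ (2F *₃ (a +₃ b)) ≡ 0F
+₃-third-sum≡0 = toWitness {a? = ∀₃? λ a → ∀₃? λ b → _ ≟₃ _} _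

+₃-sum≡0-rotate : ∀ a b c → (a +₃ b) +₃ c ≡ 0F → (b +₃ c) +₃ a ≡ 0F
+₃-sum≡0-rotate = toWitness {a? = ∀₃? λ a → ∀₃? λ b → ∀₃? λ c → (_ ≟₃ _) →-dec (_ ≟₃ _)} _

+₃-sum≡0-diagonal : ∀ a c → (a +₃ a) +₃ c ≡ 0F → c ≡ a
+₃-sum≡0-diagonal = toWitness {a? = ∀₃? λ a → ∀₃? λ c → (_ ≟₃ _) →-dec (_ ≟₃ _)} _

-- The third point −(x + y) = 2(x + y) of the line through x and y.
third : Point r → Point r → Point r
third x y = 2F · (x ⊕ y)

sum-cong : ∀ {x′ y′ z′ : Point r} → x ≡ x′ → y ≡ y′ → z ≡ z′ → (x ⊕ y) ⊕ z ≡ (x′ ⊕ y′) ⊕ z′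
sum-cong p q s = cong₂ _⊕_ (cong₂ _⊕_ p q) s

collinear-sum≡𝟎 : ∀ t₁ t₂ t₃ (b d : Point r) → t₁ ≢ t₂ → t₁ ≢ t₃ → t₂ ≢ t₃ →
                  ((b ⊕ (t₁ · d)) ⊕ (b ⊕ (t₂ · d))) ⊕ (b ⊕ (t₃ · d)) ≡ 𝟎
collinear-sum≡𝟎 t₁ t₂ t₃ []       []       _ _ _ = refl
collinear-sum≡𝟎 t₁ t₂ t₃ (b ∷ bs) (d ∷ ds) p q s =
  cong₂ _∷_ (+₃-collinear t₁ t₂ t₃ b d p q s) (collinear-sum≡𝟎 t₁ t₂ t₃ bs ds p q s)

sum≡𝟎⇒≡third : (x ⊕ y) ⊕ z ≡ 𝟎 → z ≡ third x y
sum≡𝟎⇒≡third {x = []}    {[]}    {[]}    _ = refl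
sum≡𝟎⇒≡third {x = a ∷ x} {b ∷ y} {c ∷ z} e =
  cong₂ _∷_ (+₃-sum≡0⇒≡third a b c (∷-injectiveˡ e)) (sum≡𝟎⇒≡third (∷-injectiveʳ e))

third-sum≡𝟎 : ∀ (x y : Point r) → (x ⊕ y) ⊕ third x y ≡ 𝟎
third-sum≡𝟎 []      []      = refl
third-sum≡𝟎 (a ∷ x) (b ∷ y) = cong₂ _∷_ (+₃-third-sum≡0 a b) (third-sum≡𝟎 x y)

sum≡𝟎-rotate : (x ⊕ y) ⊕ z ≡ 𝟎 → (y ⊕ z) ⊕ x ≡ 𝟎
sum≡𝟎-rotate {x = []}    {[]}    {[]}    _ = refl
sum≡𝟎-rotate {x = a ∷ x} {b ∷ y} {c ∷ z} e =
  cong₂ _∷_ (+₃-sum≡0-rotate a b c (∷-injectiveˡ e)) (sum≡𝟎-rotate (∷-injectiveʳ e))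

sum≡𝟎-diagonal : x ≡ y → (x ⊕ y) ⊕ z ≡ 𝟎 → z ≡ x
sum≡𝟎-diagonal {x = []}    {z = []}    refl _ = refl
sum≡𝟎-diagonal {x = a ∷ x} {z = c ∷ z} refl e =
  cong₂ _∷_ (+₃-sum≡0-diagonal a c (∷-injectiveˡ e)) (sum≡𝟎-diagonal refl (∷-injectiveʳ e))

-- Three distinct points with sum 𝟎 do form a line of AG(r, F₃), but only the converse,
-- ∈AG⇒IsLine, is needed.
record IsLine (x y z : Point r) : Set where
  field
    x≢y   : x ≢ y
    x≢z   : x ≢ z
    y≢z   : y ≢ z
    sum≡𝟎 : (x ⊕ y) ⊕ z ≡ 𝟎

sum≡𝟎⇒IsLine : (x ⊕ y) ⊕ z ≡ 𝟎 → x ≢ y → IsLine x y z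
sum≡𝟎⇒IsLine s x≢y = record
  { x≢y   = x≢y
  ; x≢z   = λ x≡z → x≢y (trans x≡z (sym (sum≡𝟎-diagonal (sym x≡z) (sum≡𝟎-rotate (sum≡𝟎-rotate s)))))
  ; y≢z   = λ y≡z → x≢y (sum≡𝟎-diagonal y≡z (sum≡𝟎-rotate s))
  ; sum≡𝟎 = s
  }

third-IsLine : x ≢ y → IsLine x y (third x y)
third-IsLine {x = x} {y} = sum≡𝟎⇒IsLine (third-sum≡𝟎 x y)

∈AG⇒IsLine : ∀ {L : Line r} → x ∈AG L → y ∈AG L → z ∈AG L → x ≢ y → x ≢ z → y ≢ z → IsLine x y z
∈AG⇒IsLine {L = line b d _} (t₁ , refl) (t₂ , refl) (t₃ , refl) x≢y x≢z y≢z = record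
  { x≢y   = x≢y
  ; x≢z   = x≢z
  ; y≢z   = y≢z
  ; sum≡𝟎 = collinear-sum≡𝟎 t₁ t₂ t₃ b d (param-≢ x≢y) (param-≢ x≢z) (param-≢ y≢z)
  }
  where
  param-≢ : ∀ {t u} → b ⊕ (t · d) ≢ b ⊕ (u · d) → t ≢ u
  param-≢ ≢ refl = ≢ refl

SendsNoLineToLine : (Point r → Point r) → Set
SendsNoLineToLine f = ∀ {x y z} → IsLine x y z → (f x ⊕ f y) ⊕ f z ≢ 𝟎

sendsNoLineToLine-≗ : ∀ {f g : Point r → Point r} →
                      f ≗ g → SendsNoLineToLine f → SendsNoLineToLine g
sendsNoLineToLine-≗ f≗g h {x} {y} {z} l e = h l (trans (sum-cong (f≗g x) (f≗g y) (f≗g z)) e)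

sendsNoLineToLine? : (f : Point r → Point r) → Dec (SendsNoLineToLine f)
sendsNoLineToLine? f =
  map′ onLines onPairs (∀-Point? λ x → ∀-Point? λ y → ¬? (x ≟ y) →-dec ¬? (_ ≟ _))
  where
  OnPairs : Set
  OnPairs = ∀ x y → x ≢ y → (f x ⊕ f y) ⊕ f (third x y) ≢ 𝟎
  onLines : OnPairs → SendsNoLineToLine f
  onLines h {x} {y} l =
    subst (λ z → (f x ⊕ f y) ⊕ f z ≢ 𝟎) (sym (sum≡𝟎⇒≡third (IsLine.sum≡𝟎 l))) (h x y (IsLine.x≢y l))
  onPairs : SendsNoLineToLine f → OnPairs
  onPairs h x y x≢y = h (third-IsLine x≢y)

from-injective : (σ : AGCopy r) → ∀ {p q} → from σ p ≡ from σ q → p ≡ q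
from-injective σ {p} {q} e =
  trans (sym (strictlyInverseˡ σ p)) (trans (cong (to σ) e) (strictlyInverseˡ σ q))

module _ (σ : AGCopy r) (L : Line r) where

  ∈[]⇒from∈AG : ∀ p → p ∈[ σ ] L → from σ p ∈AG L
  ∈[]⇒from∈AG p (q , q∈L , refl) = subst (_∈AG L) (sym (strictlyInverseʳ σ q)) q∈L

  ∈[]⇒IsLine : ∀ {p q s} → p ≢ q → p ≢ s → q ≢ s →
               p ∈[ σ ] L → q ∈[ σ ] L → s ∈[ σ ] L → IsLine (from σ p) (from σ q) (from σ s)
  ∈[]⇒IsLine {p} {q} {s} p≢q p≢s q≢s p∈L q∈L s∈L =
    ∈AG⇒IsLine {L = L} (∈[]⇒from∈AG p p∈L) (∈[]⇒from∈AG q q∈L) (∈[]⇒from∈AG s s∈L)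
      (λ e → p≢q (from-injective σ e))
      (λ e → p≢s (from-injective σ e))
      (λ e → q≢s (from-injective σ e))

sendsNoLineToLine⇒orthogoval : (σ τ : AGCopy r) → SendsNoLineToLine (from τ ∘ to σ) → Orthogoval σ τ
sendsNoLineToLine⇒orthogoval σ τ h L M p q s p≢q p≢s q≢s ((p∈L , p∈M) , (q∈L , q∈M) , (s∈L , s∈M)) =
  h (∈[]⇒IsLine σ L p≢q p≢s q≢s p∈L q∈L s∈L)
    (trans (sum-cong (back p) (back q) (back s))
           (IsLine.sum≡𝟎 (∈[]⇒IsLine τ M p≢q p≢s q≢s p∈M q∈M s∈M)))
  where
  back : ∀ p → from τ (to σ (from σ p)) ≡ from τ p
  back p = cong (from τ) (strictlyInverseˡ σ p)

orthogoval-sym : {σ τ : AGCopy r} → Orthogoval σ τ → Orthogoval τ σ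
orthogoval-sym h L M p q s p≢q p≢s q≢s ((p∈L , p∈M) , (q∈L , q∈M) , (s∈L , s∈M)) =
  h M L p q s p≢q p≢s q≢s ((p∈M , p∈L) , (q∈M , q∈L) , (s∈M , s∈L))

_^_ : A ↔ A → ℕ → A ↔ A
g ^ zero  = ↔-id _
g ^ suc k = g ↔-∘ (g ^ k)

^-+-cancelˡ : ∀ (g : A ↔ A) j k → from (g ^ j) ∘ to (g ^ (j + k)) ≗ to (g ^ k)
^-+-cancelˡ g zero    k x = refl
^-+-cancelˡ g (suc j) k x = trans (cong (from (g ^ j)) (strictlyInverseʳ g _)) (^-+-cancelˡ g j k x)

PowersSendNoLineToLine : ℕ → AGCopy r → Set
PowersSendNoLineToLine n g = ∀ {k} → k < n → SendsNoLineToLine (to (g ^ suc k))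

^-orthogoval : (g : AGCopy r) → PowersSendNoLineToLine n g →
               ∀ {i j} → j < i → i ≤ n → Orthogoval (g ^ i) (g ^ j)
^-orthogoval g h {j = j} j<i i≤n with m≤n⇒∃[o]m+o≡n j<i
... | o , refl = subst (λ i → Orthogoval (g ^ i) (g ^ j)) (+-suc j o)
  (sendsNoLineToLine⇒orthogoval (g ^ (j + suc o)) (g ^ j)
    (sendsNoLineToLine-≗ (sym ∘ ^-+-cancelˡ g j (suc o)) (h (<-≤-trans (m<n+m o z<s) i≤n))))

powers-mutuallyOrthogoval : (g : AGCopy r) → PowersSendNoLineToLine n g →
                            MutuallyOrthogoval {k = suc n} (λ i → g ^ toℕ i)
powers-mutuallyOrthogoval g h i j i≢j with <-cmp (toℕ i) (toℕ j)
... | tri< i<j _ _ =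
  orthogoval-sym {σ = g ^ toℕ j} {g ^ toℕ i} (^-orthogoval g h i<j (toℕ≤pred[n] j))
... | tri≈ _ i≡j _ = ⊥-elim (i≢j (toℕ-injective i≡j))
... | tri> _ _ j<i = ^-orthogoval g h j<i (toℕ≤pred[n] i)

_⊠_ : (Vec A m → Vec A m) → (Vec A n → Vec A n) → Vec A (m + n) → Vec A (m + n)
_⊠_ {m = m} f h x = f (take m x) ++ h (drop m x)

take-++ : ∀ (u : Vec A m) (v : Vec A n) → take m (u ++ v) ≡ u
take-++ {m = m} u v = ++-injectiveˡ (take m (u ++ v)) u (take++drop≡id m (u ++ v))

drop-++ : ∀ (u : Vec A m) (v : Vec A n) → drop m (u ++ v) ≡ v
drop-++ {m = m} u v = ++-injectiveʳ (take m (u ++ v)) u (take++drop≡id m (u ++ v))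

take-⊠ : ∀ (f : Vec A m → Vec A m) (h : Vec A n → Vec A n) x → take m ((f ⊠ h) x) ≡ f (take m x)
take-⊠ {m = m} f h x = take-++ (f (take m x)) (h (drop m x))

drop-⊠ : ∀ (f : Vec A m → Vec A m) (h : Vec A n → Vec A n) x → drop m ((f ⊠ h) x) ≡ h (drop m x)
drop-⊠ {m = m} f h x = drop-++ (f (take m x)) (h (drop m x))

⊠-∘ : ∀ (f f′ : Vec A m → Vec A m) (h h′ : Vec A n → Vec A n) →
      (f ⊠ h) ∘ (f′ ⊠ h′) ≗ (f ∘ f′) ⊠ (h ∘ h′)
⊠-∘ f f′ h h′ x = cong₂ _++_ (cong f (take-⊠ f′ h′ x)) (cong h (drop-⊠ f′ h′ x))

⊠-inverse : ∀ {f f′ : Vec A m → Vec A m} {h h′ : Vec A n → Vec A n} →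
            f ∘ f′ ≗ id → h ∘ h′ ≗ id → (f ⊠ h) ∘ (f′ ⊠ h′) ≗ id
⊠-inverse {m = m} {f = f} {f′} {h} {h′} ff′ hh′ x = begin
  (f ⊠ h) ((f′ ⊠ h′) x)                    ≡⟨ ⊠-∘ f f′ h h′ x ⟩
  f (f′ (take m x)) ++ h (h′ (drop m x))   ≡⟨ cong₂ _++_ (ff′ _) (hh′ _) ⟩
  take m x ++ drop m x                     ≡⟨ take++drop≡id m x ⟩
  x                                        ∎
  where open ≡-Reasoning

_⊗_ : Vec A m ↔ Vec A m → Vec A n ↔ Vec A n → Vec A (m + n) ↔ Vec A (m + n)
σ ⊗ τ = mk↔ₛ′ (to σ ⊠ to τ) (from σ ⊠ from τ)
  (⊠-inverse {f = to σ} {from σ} {to τ} {from τ} (strictlyInverseˡ σ) (strictlyInverseˡ τ))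
  (⊠-inverse {f = from σ} {to σ} {from τ} {to τ} (strictlyInverseʳ σ) (strictlyInverseʳ τ))

^-⊗ : ∀ (σ : Vec A m ↔ Vec A m) (τ : Vec A n ↔ Vec A n) k →
      to ((σ ⊗ τ) ^ k) ≗ to (σ ^ k) ⊠ to (τ ^ k)
^-⊗ {m = m} σ τ zero    x = sym (take++drop≡id m x)
^-⊗         σ τ (suc k) x =
  trans (cong (to σ ⊠ to τ) (^-⊗ σ τ k x)) (⊠-∘ (to σ) (to (σ ^ k)) (to τ) (to (τ ^ k)) x)

take-𝟎 : ∀ m → take m (𝟎 {m + n}) ≡ 𝟎
take-𝟎 zero    = refl
take-𝟎 (suc m) = cong (0F ∷_) (take-𝟎 m)

drop-𝟎 : ∀ m → drop m (𝟎 {m + n}) ≡ 𝟎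
drop-𝟎 zero    = refl
drop-𝟎 (suc m) = drop-𝟎 m

additive-sum≡𝟎 : (p : Point m → Point n) → (∀ u v → p (u ⊕ v) ≡ p u ⊕ p v) → p 𝟎 ≡ 𝟎 →
                 (x ⊕ y) ⊕ z ≡ 𝟎 → (p x ⊕ p y) ⊕ p z ≡ 𝟎
additive-sum≡𝟎 {x = x} {y} {z} p p-⊕ p-𝟎 e = begin
  (p x ⊕ p y) ⊕ p z   ≡⟨ cong (_⊕ p z) (p-⊕ x y) ⟨
  p (x ⊕ y) ⊕ p z     ≡⟨ p-⊕ (x ⊕ y) z ⟨
  p ((x ⊕ y) ⊕ z)     ≡⟨ cong p e ⟩
  p 𝟎                 ≡⟨ p-𝟎 ⟩
  𝟎                   ∎
  where open ≡-Reasoning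

take-sum≡𝟎 : ∀ {x y z : Point (m + n)} → (x ⊕ y) ⊕ z ≡ 𝟎 → (take m x ⊕ take m y) ⊕ take m z ≡ 𝟎
take-sum≡𝟎 {m = m} = additive-sum≡𝟎 (take m) (take-zipWith _+₃_) (take-𝟎 m)

drop-sum≡𝟎 : ∀ {x y z : Point (m + n)} → (x ⊕ y) ⊕ z ≡ 𝟎 → (drop m x ⊕ drop m y) ⊕ drop m z ≡ 𝟎
drop-sum≡𝟎 {m = m} = additive-sum≡𝟎 (drop m) (drop-zipWith _+₃_) (drop-𝟎 m)

take-drop-≡ : ∀ {u v : Vec A (m + n)} → take m u ≡ take m v → drop m u ≡ drop m v → u ≡ v
take-drop-≡ {m = m} {u = u} {v} t d =
  trans (sym (take++drop≡id m u)) (trans (cong₂ _++_ t d) (take++drop≡id m v))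

IsLine-split : ∀ {x y z : Point (m + n)} → IsLine x y z →
               IsLine (take m x) (take m y) (take m z) ⊎ IsLine (drop m x) (drop m y) (drop m z)
IsLine-split {m = m} {x = x} {y} {z} l with take m x ≟ take m y
... | no  tx≢ty = inj₁ (sum≡𝟎⇒IsLine (take-sum≡𝟎 (IsLine.sum≡𝟎 l)) tx≢ty)
... | yes tx≡ty = inj₂ (record
  { x≢y   = IsLine.x≢y l ∘ take-drop-≡ tx≡ty
  ; x≢z   = IsLine.x≢z l ∘ take-drop-≡ (sym tz≡tx)
  ; y≢z   = IsLine.y≢z l ∘ take-drop-≡ (trans (sym tx≡ty) (sym tz≡tx))
  ; sum≡𝟎 = drop-sum≡𝟎 (IsLine.sum≡𝟎 l)
  })
  where
  tz≡tx : take m z ≡ take m x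
  tz≡tx = sum≡𝟎-diagonal tx≡ty (take-sum≡𝟎 (IsLine.sum≡𝟎 l))

⊠-sendsNoLineToLine : ∀ {f : Point m → Point m} {h : Point n → Point n} →
                      SendsNoLineToLine f → SendsNoLineToLine h → SendsNoLineToLine (f ⊠ h)
⊠-sendsNoLineToLine {m = m} {f = f} {h} f-ok h-ok {x} {y} {z} l e with IsLine-split {m = m} l
... | inj₁ l₁ = f-ok l₁ (trans (sym (sum-cong (take-⊠ f h x) (take-⊠ f h y) (take-⊠ f h z)))
                              (take-sum≡𝟎 e))
... | inj₂ l₂ = h-ok l₂ (trans (sym (sum-cong (drop-⊠ f h x) (drop-⊠ f h y) (drop-⊠ f h z)))
                              (drop-sum≡𝟎 e))

⊗-powers : (σ : AGCopy m) (τ : AGCopy n) →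
           PowersSendNoLineToLine r σ → PowersSendNoLineToLine r τ →
           PowersSendNoLineToLine r (σ ⊗ τ)
⊗-powers σ τ σ-ok τ-ok {k} k<r =
  sendsNoLineToLine-≗ (sym ∘ ^-⊗ σ τ (suc k)) (⊠-sendsNoLineToLine (σ-ok k<r) (τ-ok k<r))

finiteOrder-↔ : (f : A → A) (n : ℕ) → (∀ x → fold x f (suc n) ≡ x) → A ↔ A
finiteOrder-↔ f n order = mk↔ₛ′ f (λ x → fold x f n) order λ x →
  trans (sym (fold-+ x f n)) (trans (cong (fold x f) (+-comm n 1)) (order x))

g₂-map : Point 2 → Point 2
g₂-map (0F ∷ 0F ∷ []) = 1F ∷ 2F ∷ []
g₂-map (0F ∷ 1F ∷ []) = 1F ∷ 0F ∷ []
g₂-map (0F ∷ 2F ∷ []) = 0F ∷ 0F ∷ []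
g₂-map (1F ∷ 0F ∷ []) = 1F ∷ 1F ∷ []
g₂-map (1F ∷ 1F ∷ []) = 2F ∷ 0F ∷ []
g₂-map (1F ∷ 2F ∷ []) = 0F ∷ 1F ∷ []
g₂-map (2F ∷ 0F ∷ []) = 0F ∷ 2F ∷ []
g₂-map (2F ∷ 1F ∷ []) = 2F ∷ 1F ∷ []
g₂-map (2F ∷ 2F ∷ []) = 2F ∷ 2F ∷ []

g₃-map : Point 3 → Point 3
g₃-map (0F ∷ 0F ∷ 0F ∷ []) = 0F ∷ 1F ∷ 0F ∷ []
g₃-map (0F ∷ 0F ∷ 1F ∷ []) = 0F ∷ 1F ∷ 2F ∷ []
g₃-map (0F ∷ 0F ∷ 2F ∷ []) = 1F ∷ 2F ∷ 2F ∷ []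
g₃-map (0F ∷ 1F ∷ 0F ∷ []) = 2F ∷ 1F ∷ 0F ∷ []
g₃-map (0F ∷ 1F ∷ 1F ∷ []) = 2F ∷ 1F ∷ 2F ∷ []
g₃-map (0F ∷ 1F ∷ 2F ∷ []) = 0F ∷ 0F ∷ 2F ∷ []
g₃-map (0F ∷ 2F ∷ 0F ∷ []) = 0F ∷ 2F ∷ 0F ∷ []
g₃-map (0F ∷ 2F ∷ 1F ∷ []) = 2F ∷ 1F ∷ 1F ∷ []
g₃-map (0F ∷ 2F ∷ 2F ∷ []) = 2F ∷ 2F ∷ 0F ∷ []
g₃-map (1F ∷ 0F ∷ 0F ∷ []) = 0F ∷ 2F ∷ 2F ∷ []
g₃-map (1F ∷ 0F ∷ 1F ∷ []) = 1F ∷ 0F ∷ 1F ∷ []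
g₃-map (1F ∷ 0F ∷ 2F ∷ []) = 1F ∷ 1F ∷ 0F ∷ []
g₃-map (1F ∷ 1F ∷ 0F ∷ []) = 0F ∷ 0F ∷ 1F ∷ []
g₃-map (1F ∷ 1F ∷ 1F ∷ []) = 2F ∷ 0F ∷ 0F ∷ []
g₃-map (1F ∷ 1F ∷ 2F ∷ []) = 1F ∷ 1F ∷ 2F ∷ []
g₃-map (1F ∷ 2F ∷ 0F ∷ []) = 1F ∷ 0F ∷ 2F ∷ []
g₃-map (1F ∷ 2F ∷ 1F ∷ []) = 1F ∷ 0F ∷ 0F ∷ []
g₃-map (1F ∷ 2F ∷ 2F ∷ []) = 1F ∷ 2F ∷ 0F ∷ []
g₃-map (2F ∷ 0F ∷ 0F ∷ []) = 0F ∷ 0F ∷ 0F ∷ []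
g₃-map (2F ∷ 0F ∷ 1F ∷ []) = 1F ∷ 2F ∷ 1F ∷ []
g₃-map (2F ∷ 0F ∷ 2F ∷ []) = 2F ∷ 0F ∷ 2F ∷ []
g₃-map (2F ∷ 1F ∷ 0F ∷ []) = 0F ∷ 1F ∷ 1F ∷ []
g₃-map (2F ∷ 1F ∷ 1F ∷ []) = 2F ∷ 0F ∷ 1F ∷ []
g₃-map (2F ∷ 1F ∷ 2F ∷ []) = 1F ∷ 1F ∷ 1F ∷ []
g₃-map (2F ∷ 2F ∷ 0F ∷ []) = 0F ∷ 2F ∷ 1F ∷ []
g₃-map (2F ∷ 2F ∷ 1F ∷ []) = 2F ∷ 2F ∷ 1F ∷ []
g₃-map (2F ∷ 2F ∷ 2F ∷ []) = 2F ∷ 2F ∷ 2F ∷ []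

g₂ : AGCopy 2
g₂ = finiteOrder-↔ g₂-map 6 (toWitness {a? = ∀-Point? λ x → fold x g₂-map 7 ≟ x} _)

g₃ : AGCopy 3
g₃ = finiteOrder-↔ g₃-map 6 (toWitness {a? = ∀-Point? λ x → fold x g₃-map 7 ≟ x} _)

g₂-powers : PowersSendNoLineToLine 6 g₂
g₂-powers = toWitness {a? = allUpTo? (λ k → sendsNoLineToLine? (to (g₂ ^ suc k))) 6} _

g₃-powers : PowersSendNoLineToLine 6 g₃
g₃-powers = toWitness {a? = allUpTo? (λ k → sendsNoLineToLine? (to (g₃ ^ suc k))) 6} _

generator : ∀ r → AGCopy (2 + r)
generator zero          = g₂
generator (suc zero)    = g₃
generator (suc (suc r)) = g₂ ⊗ generator r

generator-powers : ∀ r → PowersSendNoLineToLine 6 (generator r)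
generator-powers zero          = g₂-powers
generator-powers (suc zero)    = g₃-powers
generator-powers (suc (suc r)) = ⊗-powers g₂ (generator r) g₂-powers (generator-powers r)

mainTheorem8 : (r : ℕ) → 2 ≤ r →
    ∃ λ (S : Fin 7 → AGCopy r) → MutuallyOrthogoval S
mainTheorem8 (suc (suc r)) (s≤s (s≤s z≤n)) =
  (λ i → generator r ^ toℕ i) , powers-mutuallyOrthogoval (generator r) (generator-powers r)
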